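{- Let $n\ge 1$ and consider an $n\times n$ board with files $1,\dots,n$ and ranks $1,\dots,n$. A pawn-square is a square $s$ at file $f$ and rank $r$ with $2\le r\le n-1$; its set of potential starting files is $\mu_s=\{\,g\in\mathbb{Z}: \max(1,f-(r-2))\le g\le \min(n,f+(r-2))\,\}$. A (single-side pawn) diagram is a set $\nu$ of at most $n$ pawn-squares, each occupied by one pawn of a single colour. Let $G$ be the bipartite graph with vertex classes $\bigcup_{s\in\nu}\mu_s$ (files) and $\nu$ (pawn-squares), where a pawn-square $s$ is joined to a file $g$ iff $g\in\mu_s$. Then the diagram $\nu$ is reachable if and only if $G$ has a matching that saturates $\nu$ (a $|\nu|$-perfect matching).
   Context: Reachability model: the game starts with exactly one pawn on each square of rank $2$ (files $1,\dots,n$) and no other pawns. A move either (i) moves a pawn from file $f$, rank $r$ to an empty square on rank $r+1$ at file $f'$ with $|f'-f|\le 1$ and $1\le f'\le n$ (so pawns may move forward or diagonally forward without limit, diagonal moves being regarded as capturing empty squares), or (ii) removes (captures) a pawn from the board. A diagram is reachable if some finite sequence of moves from the starting position produces a position whose set of occupied squares is exactly $\nu$. -}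

module Defs where

open import Data.Nat using (ℕ; zero; suc; _+_; _∸_; _≤_; _≡ᵇ_; _≤ᵇ_)
open import Data.Bool using (Bool; true; false; if_then_else_; _∧_)
open import Data.Product using (_×_; _,_; Σ; ∃)
open import Data.List using (List; length; lookup)
open import Data.List.Membership.Propositional using (_∈_)
open import Data.List.Relation.Unary.All using (All)
open import Data.List.Relation.Unary.Unique.Propositional using (Unique)
open import Data.Fin using (Fin)
open import Function.Bundles using (_⇔_)
open import Function.Definitions using (Injective)
open import Relation.Binary.PropositionalEquality using (_≡_)

-- A square is a pair (file , rank); files and ranks are numbered from 1.
Square : Set
Square = ℕ × ℕ

-- A position: the occupied squares, as a Boolean predicate (file → rank → occupied?).
Position : Set
Position = ℕ → ℕ → Bool

start : ℕ → Position
start n f r = (r ≡ᵇ 2) ∧ (1 ≤ᵇ f) ∧ (f ≤ᵇ n)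

movePawn : Position → ℕ → ℕ → ℕ → Position
movePawn P f r f' x y =
  if (x ≡ᵇ f') ∧ (y ≡ᵇ suc r) then true
  else if (x ≡ᵇ f) ∧ (y ≡ᵇ r) then false
  else P x y

removePawn : Position → ℕ → ℕ → Position
removePawn P f r x y = if (x ≡ᵇ f) ∧ (y ≡ᵇ r) then false else P x y

data Reachable (n : ℕ) : Position → Set where
  begin   : Reachable n (start n)
  advance : ∀ {P} → Reachable n P → (f r f' : ℕ) →
            P f r ≡ true → P f' (suc r) ≡ false →
            1 ≤ f' → f' ≤ n → suc r ≤ n →
            f' ≤ suc f → f ≤ suc f' →
            Reachable n (movePawn P f r f')
  capture : ∀ {P} → Reachable n P → (f r : ℕ) → P f r ≡ true →
            Reachable n (removePawn P f r)

PawnSquare : ℕ → Square → Set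
PawnSquare n (f , r) = (1 ≤ f) × (f ≤ n) × (2 ≤ r) × (r ≤ n ∸ 1)

Diagram : ℕ → List Square → Set
Diagram n ν = Unique ν × All (PawnSquare n) ν × (length ν ≤ n)

DiagramReachable : ℕ → List Square → Set
DiagramReachable n ν =
  Σ Position λ P → Reachable n P × (∀ f r → (P f r ≡ true) ⇔ ((f , r) ∈ ν))

-- g ∈ μ_s  :  max(1, f-(r-2)) ≤ g ≤ min(n, f+(r-2))  (for r ≥ 2), unfolded over ℕ.
InMu : ℕ → Square → ℕ → Set
InMu n (f , r) g = (1 ≤ g) × (g ≤ n) × (f ≤ g + (r ∸ 2)) × (g ≤ f + (r ∸ 2))

-- A matching of the bipartite graph G saturating ν: an injective choice, for each
-- pawn-square s of ν, of a file g adjacent to s (i.e. g ∈ μ_s).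
SaturatingMatching : ℕ → List Square → Set
SaturatingMatching n ν =
  Σ (Fin (length ν) → ℕ) λ m → Injective _≡_ _≡_ m × (∀ i → InMu n (lookup ν i) (m i))

{-# OPTIONS --safe #-}
module Submission where

-- Label every pawn by the file it started on. A move from rank r to rank r + 1 changes
-- the file by at most one while μ widens by one file on each side, so the label of a pawn
-- on s always lies in μ_s; captures only forget pawns and distinct pawns keep distinct
-- labels. Hence the labels of the pawns of ν form a saturating matching.
-- Conversely, given a matching s ↦ g_s, bring the pawns to their targets in order of
-- decreasing rank: since |f − g_s| ≤ r − 2, the pawn on (g_s , 2) reaches s = (f , r) by
-- r − 2 forward or diagonal moves through ranks 3 … r − 1, which are still empty because
-- every pawn placed so far stands on a rank ≥ r. Finally the surplus pawns are captured.

open import Defs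
open import Data.Bool using (true; false; if_then_else_)
import Data.Bool as Bool
open import Data.Bool.Properties using (T-≡; T-∧; ¬-not)
open import Data.Empty using (⊥-elim)
open import Data.Fin as Fin using (Fin)
open import Data.List using (List; []; _∷_; length; lookup; filter; allFin; upTo; cartesianProduct)
open import Data.List.Extrema.Nat using (argmax; argmax-sel; f[⊥]≤f[argmax]; f[xs]≤f[argmax])
open import Data.List.Membership.Propositional using (_∈_; _∉_)
open import Data.List.Membership.Propositional.Properties
  using (∈-lookup; ∈-allFin; ∈-filter⁺; ∈-filter⁻; ∈-cartesianProduct⁺; ∈-upTo⁺)
open import Data.List.Properties using (filter-notAll)
open import Data.List.Relation.Unary.All as All using (All)
open import Data.List.Relation.Unary.AllPairs using (_∷_)
open import Data.List.Relation.Unary.Any as Any using (here; there)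
open import Data.List.Relation.Unary.Any.Properties using (lookup-index)
open import Data.List.Relation.Unary.Unique.Propositional using (Unique)
open import Data.Nat using (ℕ; zero; suc; _+_; _∸_; _≤_; _<_; z≤n; s≤s; _≟_)
open import Data.Nat.Properties
open import Data.Product using (_×_; _,_; ∃; proj₁; proj₂; uncurry; <_,_>)
open import Data.Product.Properties using (,-injectiveˡ; ,-injectiveʳ)
open import Data.Sum using (_⊎_; inj₁; inj₂; [_,_])
open import Function using (_∘_)
open import Function.Bundles using (_⇔_; mk⇔; Equivalence)
open import Function.Definitions using (Injective)
open import Relation.Binary.Definitions using (DecidableEquality; tri<; tri≈; tri>)
open import Relation.Binary.PropositionalEquality using (_≡_; _≢_; refl; sym; trans; cong; cong₂; subst)
open import Relation.Nullary using (Dec; yes; no; does; map′; _×-dec_; ¬?; contradiction)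
open import Relation.Nullary.Decidable using (dec-true; dec-false)

true≢false : true ≢ false
true≢false ()

lookup-injective : ∀ {A : Set} {xs : List A} → Unique xs →
                   ∀ {i j} → lookup xs i ≡ lookup xs j → i ≡ j
lookup-injective (_ ∷ _)      {Fin.zero}  {Fin.zero}  _ = refl
lookup-injective (x∉xs ∷ _)   {Fin.zero}  {Fin.suc j} e =
  contradiction e (All.lookup x∉xs (∈-lookup j))
lookup-injective (x∉xs ∷ _)   {Fin.suc i} {Fin.zero}  e =
  contradiction (sym e) (All.lookup x∉xs (∈-lookup i))
lookup-injective (_ ∷ unique) {Fin.suc i} {Fin.suc j} e = cong Fin.suc (lookup-injective unique e)

argmax-∈ : ∀ {A : Set} (f : A → ℕ) x xs → argmax f x xs ∈ x ∷ xs
argmax-∈ f x xs with argmax-sel f x xs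
... | inj₁ e    = here e
... | inj₂ ∈xs = there ∈xs

argmax-maximal : ∀ {A : Set} (f : A → ℕ) {x xs y} → y ∈ x ∷ xs → f y ≤ f (argmax f x xs)
argmax-maximal f {x} {xs} (here refl)  = f[⊥]≤f[argmax] {f = f} x xs
argmax-maximal f {x} {xs} (there y∈xs) = All.lookup (f[xs]≤f[argmax] {f = f} x xs) y∈xs

module Removal {A : Set} (_≟_ : DecidableEquality A) where

  remove : A → List A → List A
  remove a = filter (λ x → ¬? (x ≟ a))

  ∈-remove⁻ : ∀ {a xs x} → x ∈ remove a xs → x ∈ xs × x ≢ a
  ∈-remove⁻ {a} = ∈-filter⁻ (λ x → ¬? (x ≟ a))

  ∉-remove⁻ : ∀ {a xs x} → x ∉ remove a xs → x ≡ a ⊎ x ∉ xs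
  ∉-remove⁻ {a} {xs} {x} x∉ with x ≟ a
  ... | yes x≡a = inj₁ x≡a
  ... | no x≢a  = inj₂ λ x∈ → x∉ (∈-filter⁺ (λ x → ¬? (x ≟ a)) x∈ x≢a)

  length-remove : ∀ {a xs} → a ∈ xs → length (remove a xs) < length xs
  length-remove {a} {xs} a∈xs =
    filter-notAll (λ x → ¬? (x ≟ a)) xs (Any.map (λ a≡x x≢a → x≢a (sym a≡x)) a∈xs)

does≡true⇔ : ∀ {A : Set} (A? : Dec A) → does A? ≡ true ⇔ A
does≡true⇔ (yes a)  = mk⇔ (λ _ → a) (λ _ → refl)
does≡true⇔ (no ¬a) = mk⇔ (λ ()) (λ a → contradiction a ¬a)

infix 4 _≟ₛ_ _≐_ _⊑_

-- Its Boolean is definitionally the test (x ≡ᵇ a) ∧ (y ≡ᵇ b) used by movePawn and removePawn.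
_≟ₛ_ : DecidableEquality Square
(x , y) ≟ₛ (a , b) =
  map′ (uncurry (cong₂ _,_)) < ,-injectiveˡ , ,-injectiveʳ > ((x ≟ a) ×-dec (y ≟ b))

addPawn : Position → ℕ → ℕ → Position
addPawn P a b x y = if does ((x , y) ≟ₛ (a , b)) then true else P x y

_≐_ : Position → Position → Set
P ≐ Q = ∀ x y → P x y ≡ Q x y

_⊑_ : Position → Position → Set
Q ⊑ P = ∀ x y → Q x y ≡ true → P x y ≡ true

addPawn-here : ∀ P a b → addPawn P a b a b ≡ true
addPawn-here P a b = cong (if_then true else P a b) (dec-true ((a , b) ≟ₛ (a , b)) refl)

addPawn-elsewhere : ∀ P {a b x y} → (x , y) ≢ (a , b) → addPawn P a b x y ≡ P x y
addPawn-elsewhere P {a} {b} {x} {y} ne =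
  cong (if_then true else P x y) (dec-false ((x , y) ≟ₛ (a , b)) ne)

removePawn-here : ∀ P a b → removePawn P a b a b ≡ false
removePawn-here P a b = cong (if_then false else P a b) (dec-true ((a , b) ≟ₛ (a , b)) refl)

removePawn-elsewhere : ∀ P {a b x y} → (x , y) ≢ (a , b) → removePawn P a b x y ≡ P x y
removePawn-elsewhere P {a} {b} {x} {y} ne =
  cong (if_then false else P x y) (dec-false ((x , y) ≟ₛ (a , b)) ne)

removePawn-vacant : ∀ {P a b} → P a b ≡ false → removePawn P a b ≐ P
removePawn-vacant {P} {a} {b} vacant x y with (x , y) ≟ₛ (a , b)
... | yes refl = trans (removePawn-here P a b) (sym vacant)
... | no ne    = removePawn-elsewhere P ne

addPawn-removePawn : ∀ {P a b} → P a b ≡ true → addPawn (removePawn P a b) a b ≐ P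
addPawn-removePawn {P} {a} {b} occupied x y with (x , y) ≟ₛ (a , b)
... | yes refl = trans (addPawn-here (removePawn P a b) a b) (sym occupied)
... | no ne    = trans (addPawn-elsewhere (removePawn P a b) ne) (removePawn-elsewhere P ne)

removePawn-addPawn : ∀ {P a b} → P a b ≡ false → removePawn (addPawn P a b) a b ≐ P
removePawn-addPawn {P} {a} {b} vacant x y with (x , y) ≟ₛ (a , b)
... | yes refl = trans (removePawn-here (addPawn P a b) a b) (sym vacant)
... | no ne    = trans (removePawn-elsewhere (addPawn P a b) ne) (addPawn-elsewhere P ne)

addPawn-resp-≐ : ∀ {P Q} a b → P ≐ Q → addPawn P a b ≐ addPawn Q a b
addPawn-resp-≐ a b P≐Q x y = cong (if does ((x , y) ≟ₛ (a , b)) then true else_) (P≐Q x y)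

removePawn-resp-≐ : ∀ {P Q} a b → P ≐ Q → removePawn P a b ≐ removePawn Q a b
removePawn-resp-≐ a b P≐Q x y = cong (if does ((x , y) ≟ₛ (a , b)) then false else_) (P≐Q x y)

removePawn-⊑ : ∀ P a b → removePawn P a b ⊑ P
removePawn-⊑ P a b x y occupied with (x , y) ≟ₛ (a , b)
... | yes refl = ⊥-elim (true≢false (trans (sym occupied) (removePawn-here P a b)))
... | no ne    = trans (sym (removePawn-elsewhere P ne)) occupied

-- movePawn P f r f' is definitionally addPawn (removePawn P f r) f' (suc r).
movePawn-occupied : ∀ P f r f' {x y} → movePawn P f r f' x y ≡ true →
  (x , y) ≡ (f' , suc r) ⊎ ((x , y) ≢ (f' , suc r) × (x , y) ≢ (f , r) × P x y ≡ true)
movePawn-occupied P f r f' {x} {y} occupied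
  with (x , y) ≟ₛ (f' , suc r) | (x , y) ≟ₛ (f , r)
... | yes e   | _        = inj₁ e
... | no ≢tgt | yes refl = ⊥-elim (true≢false (trans (sym occupied)
                             (trans (addPawn-elsewhere (removePawn P f r) ≢tgt) (removePawn-here P f r))))
... | no ≢tgt | no ≢src  = inj₂ (≢tgt , ≢src , trans
                             (sym (trans (addPawn-elsewhere (removePawn P f r) ≢tgt)
                                         (removePawn-elsewhere P ≢src)))
                             occupied)

movePawn-resp-≐ : ∀ {P Q} f r f' → P ≐ Q → movePawn P f r f' ≐ movePawn Q f r f'
movePawn-resp-≐ f r f' P≐Q = addPawn-resp-≐ f' (suc r) (removePawn-resp-≐ f r P≐Q)

-- Positions are functions, so reachability is only available up to pointwise equality.
Reachable≐ : ℕ → Position → Set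
Reachable≐ n Q = ∃ λ P → Reachable n P × P ≐ Q

Reachable≐-resp-≐ : ∀ {n P Q} → P ≐ Q → Reachable≐ n P → Reachable≐ n Q
Reachable≐-resp-≐ P≐Q (P₀ , R , P₀≐P) = P₀ , R , λ x y → trans (P₀≐P x y) (P≐Q x y)

advance≐ : ∀ {n P} → Reachable≐ n P → (f r f' : ℕ) →
           P f r ≡ true → P f' (suc r) ≡ false →
           1 ≤ f' → f' ≤ n → suc r ≤ n → f' ≤ suc f → f ≤ suc f' →
           Reachable≐ n (movePawn P f r f')
advance≐ (P₀ , R , P₀≐P) f r f' occupied vacant 1≤f' f'≤n r<n f'≤1+f f≤1+f' =
  movePawn P₀ f r f' ,
  advance R f r f' (trans (P₀≐P f r) occupied) (trans (P₀≐P f' (suc r)) vacant)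
          1≤f' f'≤n r<n f'≤1+f f≤1+f' ,
  movePawn-resp-≐ f r f' P₀≐P

capture≐ : ∀ {n P} → Reachable≐ n P → (a b : ℕ) → Reachable≐ n (removePawn P a b)
capture≐ {P = P} reach@(P₀ , R , P₀≐P) a b with P a b in occupancy
... | true  = removePawn P₀ a b , capture R a b (trans (P₀≐P a b) occupancy) ,
              removePawn-resp-≐ a b P₀≐P
... | false = Reachable≐-resp-≐ (λ x y → sym (removePawn-vacant occupancy x y)) reach

start-occupied : ∀ n x y → start n x y ≡ true → (1 ≤ x × x ≤ n) × y ≡ 2
start-occupied n x y occupied
  with y≡2 , on-board ← Equivalence.to T-∧ (Equivalence.from T-≡ occupied)
  with 1≤x , x≤n ← Equivalence.to T-∧ on-board
  = (≤ᵇ⇒≤ 1 x 1≤x , ≤ᵇ⇒≤ x n x≤n) , ≡ᵇ⇒≡ y 2 y≡2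

start-rank₂ : ∀ {n g} → 1 ≤ g → g ≤ n → start n g 2 ≡ true
start-rank₂ 1≤g g≤n = Equivalence.to T-≡ (Equivalence.from T-∧ (≤⇒≤ᵇ 1≤g , ≤⇒≤ᵇ g≤n))

-- The starting rank 2 exceeds n when n ≤ 1, hence the bound 2 + n.
reachable-bounded : ∀ {n P x y} → Reachable n P → P x y ≡ true → x ≤ n × y ≤ 2 + n
reachable-bounded {n} {x = x} {y} begin occupied with (_ , x≤n) , refl ← start-occupied n x y occupied =
  x≤n , s≤s (s≤s z≤n)
reachable-bounded {x = x} {y} (advance {P} R f r f' _ _ _ f'≤n r<n _ _) occupied
  with movePawn-occupied P f r f' {x} {y} occupied
... | inj₁ refl             = f'≤n , ≤-trans r<n (m≤n+m _ 2)
... | inj₂ (_ , _ , before) = reachable-bounded R before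
reachable-bounded {x = x} {y} (capture {P} R f r _) occupied =
  reachable-bounded R (removePawn-⊑ P f r x y occupied)

board : ℕ → List Square
board n = cartesianProduct (upTo (suc n)) (upTo (3 + n))

reachable-on-board : ∀ {n P x y} → Reachable≐ n P → P x y ≡ true → (x , y) ∈ board n
reachable-on-board {x = x} {y} (P₀ , R , P₀≐P) occupied
  with x≤n , y≤2+n ← reachable-bounded R (trans (P₀≐P x y) occupied)
  = ∈-cartesianProduct⁺ (∈-upTo⁺ (s≤s x≤n)) (∈-upTo⁺ (s≤s y≤2+n))

removeAll : Position → List Square → Position
removeAll P []             = P
removeAll P ((a , b) ∷ S) = removePawn (removeAll P S) a b

removeAll-reachable : ∀ {n P} → Reachable≐ n P → ∀ S → Reachable≐ n (removeAll P S)
removeAll-reachable reach []             = reach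
removeAll-reachable reach ((a , b) ∷ S) = capture≐ (removeAll-reachable reach S) a b

removeAll-∈ : ∀ {P S x y} → (x , y) ∈ S → removeAll P S x y ≡ false
removeAll-∈ {P} {(a , b) ∷ S} (here refl) = removePawn-here (removeAll P S) a b
removeAll-∈ {P} {(a , b) ∷ S} {x} {y} (there ∈S) with (x , y) ≟ₛ (a , b)
... | yes refl = removePawn-here (removeAll P S) a b
... | no ne    = trans (removePawn-elsewhere (removeAll P S) ne) (removeAll-∈ ∈S)

removeAll-∉ : ∀ {P S x y} → (x , y) ∉ S → removeAll P S x y ≡ P x y
removeAll-∉ {P} {[]}          ∉S = refl
removeAll-∉ {P} {(a , b) ∷ S} ∉S =
  trans (removePawn-elsewhere (removeAll P S) (∉S ∘ here)) (removeAll-∉ (∉S ∘ there))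

open import Data.List.Membership.DecPropositional _≟ₛ_ using (_∈?_)

reachable-⊑ : ∀ {n P Q} → Reachable≐ n P → Q ⊑ P → Reachable≐ n Q
reachable-⊑ {n} {P} {Q} reach Q⊑P = Reachable≐-resp-≐ agrees (removeAll-reachable reach vacated)
  where
  Vacant? = λ (s : Square) → Q (proj₁ s) (proj₂ s) Bool.≟ false

  vacated : List Square
  vacated = filter Vacant? (board n)

  agrees : removeAll P vacated ≐ Q
  agrees x y with (x , y) ∈? vacated
  ... | yes ∈vacated = trans (removeAll-∈ ∈vacated) (sym (proj₂ (∈-filter⁻ Vacant? ∈vacated)))
  ... | no ∉vacated  = trans (removeAll-∉ ∉vacated) kept
    where
    kept : P x y ≡ Q x y
    kept with Q x y in q | P x y in p
    ... | true  | _     = trans (sym p) (Q⊑P x y q)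
    ... | false | false = refl
    ... | false | true  =
      contradiction (∈-filter⁺ Vacant? (reachable-on-board reach p) q) ∉vacated

occupancy : List Square → Position
occupancy ν x y = does ((x , y) ∈? ν)

diagramReachable : ∀ {n ν} → Reachable≐ n (occupancy ν) → DiagramReachable n ν
diagramReachable {ν = ν} (P , R , P≐ν) = P , R , λ x y →
  let open Equivalence (does≡true⇔ ((x , y) ∈? ν))
  in mk⇔ (λ occupied → to (trans (sym (P≐ν x y)) occupied)) (λ ∈ν → trans (P≐ν x y) (from ∈ν))

InMu-advance : ∀ {n f r f' g} → 2 ≤ r → f' ≤ suc f → f ≤ suc f' →
               InMu n (f , r) g → InMu n (f' , suc r) g
InMu-advance {r = suc zero} (s≤s ())
InMu-advance {f = f} {suc (suc k)} {f'} {g} _ f'≤1+f f≤1+f' (1≤g , g≤n , f≤g+k , g≤f+k) =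
  1≤g , g≤n ,
  ≤-trans f'≤1+f (≤-trans (s≤s f≤g+k) (≤-reflexive (sym (+-suc g k)))) ,
  ≤-trans g≤f+k (≤-trans (+-monoˡ-≤ k f≤1+f') (≤-reflexive (sym (+-suc f' k))))

record Origins (n : ℕ) (P : Position) : Set where
  field
    origin           : ℕ → ℕ → ℕ
    rank≥2           : ∀ {x y} → P x y ≡ true → 2 ≤ y
    origin-∈μ        : ∀ {x y} → P x y ≡ true → InMu n (x , y) (origin x y)
    origin-injective : ∀ {x y x' y'} → P x y ≡ true → P x' y' ≡ true →
                       origin x y ≡ origin x' y' → (x , y) ≡ (x' , y')

origins-start : ∀ n → Origins n (start n)
origins-start n = record
  { origin           = λ x _ → x
  ; rank≥2           = λ {x} {y} occupied → ≤-reflexive (sym (proj₂ (start-occupied n x y occupied)))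
  ; origin-∈μ        = λ {x} {y} occupied → let (1≤x , x≤n) , _ = start-occupied n x y occupied
                                          in 1≤x , x≤n , m≤m+n x (y ∸ 2) , m≤m+n x (y ∸ 2)
  ; origin-injective = λ {x} {y} {x'} {y'} occupied occupied' x≡x' →
      cong₂ _,_ x≡x' (trans (proj₂ (start-occupied n x y occupied))
                            (sym (proj₂ (start-occupied n x' y' occupied'))))
  }

origins-⊑ : ∀ {n P Q} → Q ⊑ P → Origins n P → Origins n Q
origins-⊑ {Q = Q} Q⊑P O = record
  { origin           = origin
  ; rank≥2           = λ {x} {y} occupied → rank≥2 (Q⊑P x y occupied)
  ; origin-∈μ        = λ {x} {y} occupied → origin-∈μ (Q⊑P x y occupied)
  ; origin-injective = λ {x} {y} {x'} {y'} occupied occupied' →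
      origin-injective (Q⊑P x y occupied) (Q⊑P x' y' occupied')
  }
  where open Origins O

origins-advance : ∀ {n P f r f'} → Origins n P → P f r ≡ true → f' ≤ suc f → f ≤ suc f' →
                  Origins n (movePawn P f r f')
origins-advance {n} {P} {f} {r} {f'} O occupied f'≤1+f f≤1+f' = record
  { origin           = origin′
  ; rank≥2           = λ {x} {y} occupied′ → moved-or-stayed x y occupied′
      (λ { refl _ → ≤-trans (rank≥2 occupied) (n≤1+n r) })
      (λ _ before _ → rank≥2 before)
  ; origin-∈μ        = λ {x} {y} occupied′ → moved-or-stayed x y occupied′
      (λ { refl same → subst (InMu n (f' , suc r)) (sym same)
             (InMu-advance (rank≥2 occupied) f'≤1+f f≤1+f' (origin-∈μ occupied)) })
      (λ _ before same → subst (InMu n (x , y)) (sym same) (origin-∈μ before))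
  ; origin-injective = injective
  }
  where
  open Origins O
  P′ = movePawn P f r f'

  origin′ : ℕ → ℕ → ℕ
  origin′ x y = if does ((x , y) ≟ₛ (f' , suc r)) then origin f r else origin x y

  moved-or-stayed : ∀ {A : Set} x y → P′ x y ≡ true →
         ((x , y) ≡ (f' , suc r) → origin′ x y ≡ origin f r → A) →
         ((x , y) ≢ (f , r) → P x y ≡ true → origin′ x y ≡ origin x y → A) → A
  moved-or-stayed x y occupied′ moved stayed with movePawn-occupied P f r f' occupied′
  ... | inj₁ e                    = moved e (cong (if_then origin f r else origin x y)
                                               (dec-true ((x , y) ≟ₛ (f' , suc r)) e))
  ... | inj₂ (≢tgt , ≢src , before) = stayed ≢src before (cong (if_then origin f r else origin x y)
                                               (dec-false ((x , y) ≟ₛ (f' , suc r)) ≢tgt))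

  injective : ∀ {x y x' y'} → P′ x y ≡ true → P′ x' y' ≡ true →
              origin′ x y ≡ origin′ x' y' → (x , y) ≡ (x' , y')
  injective {x} {y} {x'} {y'} occ occ' same = moved-or-stayed x y occ
    (λ tgt o → moved-or-stayed x' y' occ'
      (λ tgt' _ → trans tgt (sym tgt'))
      (λ ≢src' before' o' → contradiction
        (origin-injective occupied before' (trans (sym o) (trans same o'))) (≢src' ∘ sym)))
    (λ ≢src before o → moved-or-stayed x' y' occ'
      (λ _ o' → contradiction
        (origin-injective occupied before (trans (sym o') (trans (sym same) o))) (≢src ∘ sym))
      (λ _ before' o' → origin-injective before before' (trans (sym o) (trans same o'))))

origins : ∀ {n P} → Reachable n P → Origins n P
origins {n} begin = origins-start n
origins (advance R f r f' occupied _ _ _ _ f'≤1+f f≤1+f') =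
  origins-advance (origins R) occupied f'≤1+f f≤1+f'
origins (capture {P} R f r _) = origins-⊑ (removePawn-⊑ P f r) (origins R)

reachable⇒saturatingMatching : ∀ {n ν} → Unique ν → DiagramReachable n ν → SaturatingMatching n ν
reachable⇒saturatingMatching {n} {ν} unique (P , R , P⇔ν) =
  matching , (λ same → lookup-injective unique (origin-injective (occupied _) (occupied _) same)) ,
  λ i → origin-∈μ (occupied i)
  where
  open Origins (origins R)
  occupied : ∀ i → P (proj₁ (lookup ν i)) (proj₂ (lookup ν i)) ≡ true
  occupied i = Equivalence.from (P⇔ν _ _) (∈-lookup i)
  matching : Fin (length ν) → ℕ
  matching i = origin (proj₁ (lookup ν i)) (proj₂ (lookup ν i))

within-zero : ∀ {f g} → f ≤ g + 0 → g ≤ f + 0 → g ≡ f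
within-zero {f} {g} f≤g+0 g≤f+0 =
  ≤-antisym (subst (g ≤_) (+-identityʳ f) g≤f+0) (subst (f ≤_) (+-identityʳ g) f≤g+0)

InMu-rank₂ : ∀ {n f g} → InMu n (f , 2) g → g ≡ f
InMu-rank₂ (_ , _ , f≤g+0 , g≤f+0) = within-zero f≤g+0 g≤f+0

step-toward : ∀ {n g f k} → 1 ≤ g → g ≤ n → f ≤ n → f ≤ g + suc k → g ≤ f + suc k →
  ∃ λ h → (1 ≤ h × h ≤ n) × (h ≤ g + k × g ≤ h + k) × (f ≤ suc h × h ≤ suc f)
step-toward {g = g} {f} {k} 1≤g g≤n f≤n f≤g+1+k g≤f+1+k with <-cmp f g
... | tri< f<g _ _ =
  suc f , (s≤s z≤n , ≤-trans f<g g≤n) ,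
  (≤-trans f<g (m≤m+n g k) , subst (g ≤_) (+-suc f k) g≤f+1+k) , (≤-trans (n≤1+n f) (n≤1+n _) , ≤-refl)
... | tri≈ _ refl _ = f , (1≤g , g≤n) , (m≤m+n f k , m≤m+n f k) , (n≤1+n f , n≤1+n f)
step-toward {g = g} {suc h} {k} 1≤g g≤n f≤n f≤g+1+k g≤f+1+k | tri> _ _ g<f =
  h , (≤-trans 1≤g (≤-pred g<f) , ≤-trans (n≤1+n h) f≤n) ,
  (≤-pred (subst (suc h ≤_) (+-suc g k) f≤g+1+k) , ≤-trans (≤-pred g<f) (m≤m+n h k)) ,
  (≤-refl , ≤-trans (n≤1+n h) (n≤1+n _))

relocate : Position → ℕ → ℕ → ℕ → Position
relocate Q g f r = addPawn (removePawn Q g 2) f r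

vacated-within : ∀ {Q g h} k → h ≤ g + k → g ≤ h + k → (1 ≤ k → Q h (2 + k) ≡ false) →
                 removePawn Q g 2 h (2 + k) ≡ false
vacated-within {Q} {g} {h} k h≤g+k g≤h+k vacant with (h , 2 + k) ≟ₛ (g , 2)
vacated-within {Q} {g} {h} zero    h≤g g≤h _      | no ne = contradiction
  (cong (_, 2) (within-zero g≤h h≤g)) ne
vacated-within {Q}         (suc k) _   _   vacant | no ne =
  trans (removePawn-elsewhere Q ne) (vacant (s≤s z≤n))
... | yes e =
  subst (λ s → removePawn Q g 2 (proj₁ s) (proj₂ s) ≡ false) (sym e) (removePawn-here Q g 2)

relocate-reachable : ∀ {n Q g f r} → Reachable≐ n Q → Q g 2 ≡ true →
  PawnSquare n (f , r) → InMu n (f , r) g →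
  (∀ x y → 3 ≤ y → y < r → Q x y ≡ false) → (3 ≤ r → Q f r ≡ false) →
  Reachable≐ n (relocate Q g f r)
relocate-reachable {r = zero}     _ _ (_ , _ , ()     , _) _ _ _
relocate-reachable {r = suc zero} _ _ (_ , _ , s≤s () , _) _ _ _
relocate-reachable {Q = Q} {g} {r = suc (suc zero)} reach occupied _ f∈μ _ _
  with refl ← InMu-rank₂ f∈μ =
  Reachable≐-resp-≐ (λ x y → sym (addPawn-removePawn {Q} {g} {2} occupied x y)) reach
relocate-reachable {n} {Q} {g} {f} {suc (suc (suc k))} reach occupied
                   (1≤f , f≤n , _ , 3+k≤n-1) (1≤g , g≤n , f≤g+1+k , g≤f+1+k) below vacant =
  let h , (1≤h , h≤n) , (h≤g+k , g≤h+k) , (f≤1+h , h≤1+f) =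
        step-toward 1≤g g≤n f≤n f≤g+1+k g≤f+1+k

      to-h : Reachable≐ n (relocate Q g h (2 + k))
      to-h = relocate-reachable reach occupied
        (1≤h , h≤n , s≤s (s≤s z≤n) , ≤-trans (n≤1+n _) 3+k≤n-1) (1≤g , g≤n , h≤g+k , g≤h+k)
        (λ x y 3≤y y<2+k → below x y 3≤y (m≤n⇒m≤1+n y<2+k))
        (λ 3≤2+k → below h (2 + k) 3≤2+k ≤-refl)

      target-vacant : relocate Q g h (2 + k) f (3 + k) ≡ false
      target-vacant = trans (addPawn-elsewhere (removePawn Q g 2) {h} {2 + k} λ ())
                      (trans (removePawn-elsewhere Q {g} {2} λ ()) (vacant (s≤s (s≤s (s≤s z≤n)))))
  in Reachable≐-resp-≐
       (addPawn-resp-≐ f (3 + k) (removePawn-addPawn {removePawn Q g 2} {h} {2 + k}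
         (vacated-within {Q} k h≤g+k g≤h+k (λ 1≤k → below h (2 + k) (s≤s (s≤s 1≤k)) ≤-refl))))
       (advance≐ to-h h (2 + k) f (addPawn-here (removePawn Q g 2) h (2 + k)) target-vacant
                 1≤f f≤n (≤-trans 3+k≤n-1 (m∸n≤m n 1)) f≤1+h h≤1+f)

module Placement {n : ℕ} {ν : List Square} (ν-unique : Unique ν) (ν-pawns : All (PawnSquare n) ν)
                 (m : Fin (length ν) → ℕ) (m-injective : Injective _≡_ _≡_ m)
                 (m∈μ : ∀ i → InMu n (lookup ν i) (m i)) where

  open Removal (Fin._≟_ {length ν})

  Index : Set
  Index = Fin (length ν)

  file rank : Index → ℕ
  file i = proj₁ (lookup ν i)
  rank i = proj₂ (lookup ν i)

  target-on-origin : ∀ {i j} → lookup ν j ≡ (m i , 2) → j ≡ i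
  target-on-origin {i} {j} e = m-injective (InMu-rank₂ (subst (λ s → InMu n s (m j)) e (m∈μ j)))

  record Stage (todo : List Index) (Q : Position) : Set where
    field
      reachable   : Reachable≐ n Q
      placed      : ∀ {i} → i ∉ todo → Q (file i) (rank i) ≡ true
      waiting     : ∀ {i} → i ∈ todo → Q (m i) 2 ≡ true
      only-placed : ∀ {x y} → Q x y ≡ true → 3 ≤ y → ∃ λ j → j ∉ todo × lookup ν j ≡ (x , y)
      todo-lower  : ∀ {i j} → i ∈ todo → j ∉ todo → rank i ≤ rank j

  initial : Stage (allFin (length ν)) (start n)
  initial = record
    { reachable   = start n , begin , λ _ _ → refl
    ; placed      = λ {i} i∉ → contradiction (∈-allFin i) i∉
    ; waiting     = λ {i} _ → let 1≤mi , mi≤n , _ = m∈μ i in start-rank₂ 1≤mi mi≤n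
    ; only-placed = λ {x} {y} occupied 3≤y →
        contradiction (subst (3 ≤_) (proj₂ (start-occupied n x y occupied)) 3≤y) λ { (s≤s (s≤s ())) }
    ; todo-lower  = λ {_} {j} _ j∉ → contradiction (∈-allFin j) j∉
    }

  -- Every pawn above rank 2 is placed, and placed pawns stand no lower than i, so the ranks
  -- strictly between 2 and rank i are empty and the pawn on (m i , 2) can climb to its target.
  place-highest : ∀ {todo Q i} → Stage todo Q → i ∈ todo → (∀ {j} → j ∈ todo → rank j ≤ rank i) →
                  Stage (remove i todo) (relocate Q (m i) (file i) (rank i))
  place-highest {todo} {Q} {i} stage i∈todo highest = record
    { reachable   = relocate-reachable reachable (waiting i∈todo) (All.lookup ν-pawns (∈-lookup i))
                      (m∈μ i) below target-vacant
    ; placed      = placed′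
    ; waiting     = waiting′
    ; only-placed = only-placed′
    ; todo-lower  = λ {a} {b} a∈′ b∉′ → let a∈todo , _ = ∈-remove⁻ {i} {todo} a∈′ in
        [ (λ { refl → highest a∈todo }) , todo-lower a∈todo ] (∉-remove⁻ {i} {todo} b∉′)
    }
    where
    open Stage stage
    Q′ = relocate Q (m i) (file i) (rank i)

    placed-apart : ∀ {j} → j ∉ todo → lookup ν j ≢ lookup ν i
    placed-apart j∉todo e = j∉todo (subst (_∈ todo) (sym (lookup-injective ν-unique e)) i∈todo)

    below : ∀ x y → 3 ≤ y → y < rank i → Q x y ≡ false
    below x y 3≤y y<rank = ¬-not λ occupied →
      let j , j∉todo , e = only-placed occupied 3≤y
      in <⇒≱ y<rank (subst (rank i ≤_) (cong proj₂ e) (todo-lower i∈todo j∉todo))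

    target-vacant : 3 ≤ rank i → Q (file i) (rank i) ≡ false
    target-vacant 3≤rank = ¬-not λ occupied →
      let j , j∉todo , e = only-placed occupied 3≤rank in placed-apart j∉todo e

    placed′ : ∀ {j} → j ∉ remove i todo → Q′ (file j) (rank j) ≡ true
    placed′ {j} j∉′ with ∉-remove⁻ {i} {todo} j∉′
    ... | inj₁ refl    = addPawn-here (removePawn Q (m i) 2) (file i) (rank i)
    ... | inj₂ j∉todo =
      trans (addPawn-elsewhere (removePawn Q (m i) 2) (placed-apart j∉todo))
            (trans (removePawn-elsewhere Q λ e →
                      placed-apart j∉todo (cong (lookup ν) (target-on-origin e)))
                   (placed j∉todo))

    waiting′ : ∀ {j} → j ∈ remove i todo → Q′ (m j) 2 ≡ true
    waiting′ {j} j∈′ = let j∈todo , j≢i = ∈-remove⁻ {i} {todo} j∈′ in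
      trans (addPawn-elsewhere (removePawn Q (m i) 2) (λ e → j≢i (sym (target-on-origin (sym e)))))
            (trans (removePawn-elsewhere Q {m i} {2} (j≢i ∘ m-injective ∘ cong proj₁))
                   (waiting j∈todo))

    only-placed′ : ∀ {x y} → Q′ x y ≡ true → 3 ≤ y →
                   ∃ λ j → j ∉ remove i todo × lookup ν j ≡ (x , y)
    only-placed′ {x} {y} occupied 3≤y with (x , y) ≟ₛ (file i , rank i) | (x , y) ≟ₛ (m i , 2)
    ... | yes e   | _        = i , (λ i∈′ → proj₂ (∈-remove⁻ {i} {todo} i∈′) refl) , sym e
    ... | no _    | yes refl = contradiction 3≤y λ { (s≤s (s≤s ())) }
    ... | no ≢tgt | no ≢org  =
      let j , j∉todo , e = only-placed (trans (sym (trans (addPawn-elsewhere (removePawn Q (m i) 2) ≢tgt)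
                                                           (removePawn-elsewhere Q ≢org))) occupied) 3≤y
      in j , j∉todo ∘ proj₁ ∘ ∈-remove⁻ {i} {todo} , e

  complete : ∀ {todo Q} → Stage todo Q → ∃ (Stage [])
  complete {todo} = go (length todo) ≤-refl
    where
    go : ∀ c {todo Q} → length todo ≤ c → Stage todo Q → ∃ (Stage [])
    go _       {[]}     _   stage = _ , stage
    go (suc c) {t ∷ ts} len stage =
      go c (≤-pred (≤-trans (length-remove i∈) len)) (place-highest stage i∈ (argmax-maximal rank))
      where i∈ = argmax-∈ rank t ts

  matching⇒reachable : DiagramReachable n ν
  matching⇒reachable with Q , final ← complete initial =
    diagramReachable (reachable-⊑ (Stage.reachable final) ν⊑Q)
    where
    ν⊑Q : occupancy ν ⊑ Q
    ν⊑Q x y occupied = let ∈ν = Equivalence.to (does≡true⇔ ((x , y) ∈? ν)) occupied in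
      subst (λ s → Q (proj₁ s) (proj₂ s) ≡ true) (sym (lookup-index ∈ν)) (Stage.placed final λ ())

theorem1 : (n : ℕ) → 1 ≤ n → (ν : List Square) → Diagram n ν →
    DiagramReachable n ν ⇔ SaturatingMatching n ν
theorem1 n _ ν (unique , pawns , _) = mk⇔ (reachable⇒saturatingMatching unique)
  λ (m , m-injective , m∈μ) → Placement.matching⇒reachable unique pawns m m-injective m∈μ
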